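{- Let $T=2^\ell$ for a non-negative integer $\ell$, and let jobs $j$ have integer release dates $r_j\in[0,T)$. For each job $j$ let $\mathrm{Seg}(j)$ be the sequence of dyadic segments produced by the procedure FormSegments($j$) described below. Suppose $(j,S)$ and $(j',S')$ are job-segments (i.e. $S\in\mathrm{Seg}(j)$, $S'\in\mathrm{Seg}(j')$) such that there is an integer time $t$ with $[t,t+1]\subseteq S$ and $[t,t+1]\subseteq S'$. Suppose $r_j\le r_{j'}$, $S\in\mathcal{S}_s$ and $S'\in\mathcal{S}_{s'}$. Then $s\ge s'$.
   Context: For $s=0,\dots,\ell$, $\mathcal{S}_s$ denotes the set of dyadic segments of length $2^s$ in $[0,T]$: $\{[i\cdot 2^s,(i+1)\cdot 2^s] : i=0,1,\dots,T/2^s-1\}$. Procedure FormSegments($j$): initialize $t\leftarrow r_j$; then for $s=0,1,2,\dots$ (stopping once $t=T$): (i) if $t$ is a multiple of $2^{s+1}$, append the segments $[t,t+2^s]$ and $[t+2^s,t+2^{s+1}]$ (both in $\mathcal{S}_s$) to $\mathrm{Seg}(j)$ and set $t\leftarrow t+2^{s+1}$; (ii) otherwise append the segment $[t,t+2^s]$ (in $\mathcal{S}_s$) to $\mathrm{Seg}(j)$ and set $t\leftarrow t+2^s$. The segments of $\mathrm{Seg}(j)$ are disjoint (except at endpoints) and partition $[r_j,T]$. A pair $(j,S)$ with $S\in\mathrm{Seg}(j)$ is called a job-segment. -}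

module Defs where

open import Data.Nat using (ℕ; zero; suc; _+_; _*_; _^_; _≤_)
open import Data.Nat.Divisibility using (_∣?_)
open import Data.Nat.Properties using (_≟_)
open import Data.Product using (_×_; _,_; ∃)
open import Data.List using (List; []; _∷_)
open import Relation.Nullary using (yes; no)
open import Relation.Binary.PropositionalEquality using (_≡_)

Segment : Set
Segment = ℕ × ℕ

InLevel : (T s : ℕ) → Segment → Set
InLevel T s (a , b) = ∃ λ i → a ≡ i * 2 ^ s × b ≡ suc i * 2 ^ s × suc i * 2 ^ s ≤ T

-- The loop of FormSegments: current level s, current time t, fuel bounding the
-- number of remaining levels (the loop stops as soon as t = T).
formLoop : (T fuel s t : ℕ) → List Segment
formLoop T zero s t = []
formLoop T (suc fuel) s t with t ≟ T
... | yes _ = []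
... | no _ with 2 ^ suc s ∣? t
...   | yes _ = (t , t + 2 ^ s) ∷ (t + 2 ^ s , t + 2 ^ suc s) ∷ formLoop T fuel (suc s) (t + 2 ^ suc s)
...   | no _  = (t , t + 2 ^ s) ∷ formLoop T fuel (suc s) (t + 2 ^ s)

-- Seg(j) for a job with release date r, horizon T = 2^ℓ.  The levels s range
-- over 0,…,ℓ, so ℓ+1 units of fuel suffice (the loop reaches t = T earlier).
Seg : (ℓ r : ℕ) → List Segment
Seg ℓ r = formLoop (2 ^ ℓ) (suc ℓ) 0 r

UnitIn : ℕ → Segment → Set
UnitIn t (a , b) = a ≤ t × suc t ≤ b

module Submission where

-- Write levelStart r s for the value of t when FormSegments(j) with r = r_j
-- enters level s.  Every segment of level s lies in [levelStart r s,
-- levelStart r (s+1)], and levelStart r s is a multiple of 2^s.  The step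
-- t ↦ t + 2^s or t + 2^(s+1) is monotone on multiples of 2^s, so levelStart is
-- monotone in the release date as well as in the level.  If s < s', a unit
-- [t, t+1] in a level-s segment of j ends by levelStart r (s+1) ≤ levelStart r s'
-- ≤ levelStart r' s', where the level-s' segments of j' only begin.

open import Defs
open import Data.Nat using (ℕ; zero; suc; _+_; _*_; _^_; _≤_; _<_; _≤′_; ≤′-refl; ≤′-step)
open import Data.Nat.Properties
open import Data.Nat.Divisibility using (_∣_; divides; _∣?_; 1∣_; ∣m∣n⇒∣m+n; ∣-refl)
open import Data.Nat.Solver using (module +-*-Solver)
open import Data.List.Membership.Propositional using (_∈_)
open import Data.List.Relation.Unary.Any using (here; there)
open import Data.Product using (_,_; proj₁; proj₂; ∃)
open import Data.Sum using (_⊎_; inj₁; inj₂)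
open import Relation.Nullary using (yes; no; ¬_; contradiction)
open import Relation.Binary.PropositionalEquality using (_≡_; refl; sym; trans; subst₂)
open +-*-Solver

even⊎odd : ∀ q → ∃ λ k → q ≡ k * 2 ⊎ q ≡ suc (k * 2)
even⊎odd zero = 0 , inj₁ refl
even⊎odd (suc q) with even⊎odd q
... | k , inj₁ refl = k , inj₂ refl
... | k , inj₂ refl = suc k , inj₁ refl

∣∧∤⇒∣+ : ∀ {m t} → m ∣ t → ¬ 2 * m ∣ t → 2 * m ∣ t + m
∣∧∤⇒∣+ {m} (divides q refl) ∤ with even⊎odd q
... | k , inj₁ refl = contradiction (divides k (*-assoc k 2 m)) ∤
... | k , inj₂ refl = divides (suc k)
  (solve 2 (λ k m → (con 1 :+ k :* con 2) :* m :+ m := (con 1 :+ k) :* (con 2 :* m)) refl k m)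

∣∧∣∧<⇒+≤ : ∀ {m t t'} → m ∣ t → m ∣ t' → t < t' → t + m ≤ t'
∣∧∣∧<⇒+≤ {m} (divides a refl) (divides b refl) a*m<b*m =
  ≤-trans (≤-reflexive (+-comm (a * m) m)) (*-monoˡ-≤ m (*-cancelʳ-< m a b a*m<b*m))

^-injectiveʳ : ∀ {m k s} → 1 < m → m ^ k ≡ m ^ s → k ≡ s
^-injectiveʳ {m} 1<m e = ≤-antisym
  (≮⇒≥ λ s<k → <-irrefl (sym e) (^-monoʳ-< m 1<m s<k))
  (≮⇒≥ λ k<s → <-irrefl e (^-monoʳ-< m 1<m k<s))

+2^suc-split : ∀ t s → t + 2 ^ suc s ≡ t + 2 ^ s + 2 ^ s
+2^suc-split t s = solve 2 (λ t m → t :+ con 2 :* m := t :+ m :+ m) refl t (2 ^ s)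

advance : ℕ → ℕ → ℕ
advance s t with 2 ^ suc s ∣? t
... | yes _ = t + 2 ^ suc s
... | no _  = t + 2 ^ s

advance-∣ : ∀ s t → 2 ^ suc s ∣ t → advance s t ≡ t + 2 ^ suc s
advance-∣ s t ∣t with 2 ^ suc s ∣? t
... | yes _ = refl
... | no ∤t = contradiction ∣t ∤t

advance-∤ : ∀ s t → ¬ 2 ^ suc s ∣ t → advance s t ≡ t + 2 ^ s
advance-∤ s t ∤t with 2 ^ suc s ∣? t
... | yes ∣t = contradiction ∣t ∤t
... | no _  = refl

+2^s≤advance : ∀ s t → t + 2 ^ s ≤ advance s t
+2^s≤advance s t with 2 ^ suc s ∣? t
... | yes _ = +-monoʳ-≤ t (m≤m+n (2 ^ s) _)
... | no _  = ≤-refl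

advance-∣-next : ∀ s t → 2 ^ s ∣ t → 2 ^ suc s ∣ advance s t
advance-∣-next s t ∣t with 2 ^ suc s ∣? t
... | yes ∣t' = ∣m∣n⇒∣m+n ∣t' ∣-refl
... | no ∤t'  = ∣∧∤⇒∣+ ∣t ∤t'

advance-mono-≤ : ∀ s {t t'} → 2 ^ s ∣ t → 2 ^ s ∣ t' → t ≤ t' → advance s t ≤ advance s t'
advance-mono-≤ s {t} {t'} ∣t ∣t' t≤t' with 2 ^ suc s ∣? t | 2 ^ suc s ∣? t'
... | yes _ | yes _ = +-monoˡ-≤ _ t≤t'
... | no _  | no _  = +-monoˡ-≤ _ t≤t'
... | no _  | yes _ = +-mono-≤ t≤t' (m≤n*m (2 ^ s) 2)
... | yes ∣₂t | no ∤₂t' with m≤n⇒m<n∨m≡n t≤t'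
...   | inj₂ refl = contradiction ∣₂t ∤₂t'
...   | inj₁ t<t' = begin
  t + 2 ^ suc s       ≡⟨ +2^suc-split t s ⟩
  t + 2 ^ s + 2 ^ s   ≤⟨ +-monoˡ-≤ (2 ^ s) (∣∧∣∧<⇒+≤ ∣t ∣t' t<t') ⟩
  t' + 2 ^ s          ∎
  where open ≤-Reasoning

levelStart : ℕ → ℕ → ℕ
levelStart r zero    = r
levelStart r (suc s) = advance s (levelStart r s)

levelStart-∣ : ∀ r s → 2 ^ s ∣ levelStart r s
levelStart-∣ r zero    = 1∣ r
levelStart-∣ r (suc s) = advance-∣-next s (levelStart r s) (levelStart-∣ r s)

levelStart-monoˡ-≤ : ∀ {r r'} s → r ≤ r' → levelStart r s ≤ levelStart r' s
levelStart-monoˡ-≤ zero    r≤r' = r≤r'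
levelStart-monoˡ-≤ {r} {r'} (suc s) r≤r' =
  advance-mono-≤ s (levelStart-∣ r s) (levelStart-∣ r' s) (levelStart-monoˡ-≤ s r≤r')

levelStart-monoʳ-≤ : ∀ r {s s'} → s ≤ s' → levelStart r s ≤ levelStart r s'
levelStart-monoʳ-≤ r s≤s' = go (≤⇒≤′ s≤s')
  where
  go : ∀ {s s'} → s ≤′ s' → levelStart r s ≤ levelStart r s'
  go ≤′-refl        = ≤-refl
  go (≤′-step {n} s≤n) = ≤-trans (go s≤n) (≤-trans (m≤m+n _ (2 ^ n)) (+2^s≤advance n (levelStart r n)))

record SegmentAtLevel (r s : ℕ) (S : Segment) : Set where
  constructor segmentAtLevel
  field
    start≤ : levelStart r s ≤ proj₁ S
    ≤end   : proj₂ S ≤ levelStart r (suc s)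
    length : proj₂ S ≡ proj₁ S + 2 ^ s

formLoop-SegmentAtLevel : ∀ T fuel s r (S : Segment) →
  S ∈ formLoop T fuel s (levelStart r s) → ∃ λ k → SegmentAtLevel r k S
formLoop-SegmentAtLevel T (suc fuel) s r S S∈ with levelStart r s ≟ T
formLoop-SegmentAtLevel T (suc fuel) s r S () | yes _
... | no _ with 2 ^ suc s ∣? levelStart r s
... | yes ∣t with S∈
...   | here refl = s , segmentAtLevel ≤-refl (+2^s≤advance s _) refl
...   | there (here refl) = s , segmentAtLevel (m≤m+n _ (2 ^ s))
          (≤-reflexive (sym (advance-∣ s _ ∣t))) (+2^suc-split (levelStart r s) s)
...   | there (there S∈') rewrite sym (advance-∣ s (levelStart r s) ∣t) =
          formLoop-SegmentAtLevel T fuel (suc s) r S S∈'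
formLoop-SegmentAtLevel T (suc fuel) s r S S∈ | no _ | no ∤t with S∈
...   | here refl = s , segmentAtLevel ≤-refl (+2^s≤advance s _) refl
...   | there S∈' rewrite sym (advance-∤ s (levelStart r s) ∤t) =
          formLoop-SegmentAtLevel T fuel (suc s) r S S∈'

InLevel-length : ∀ {T s a b} → InLevel T s (a , b) → b ≡ a + 2 ^ s
InLevel-length {s = s} (i , refl , refl , _) = +-comm (2 ^ s) (i * 2 ^ s)

SegmentAtLevel∧InLevel⇒≡ : ∀ {r k} T s S → SegmentAtLevel r k S → InLevel T s S → k ≡ s
SegmentAtLevel∧InLevel⇒≡ {k = k} T s (a , b) (segmentAtLevel _ _ b≡a+2^k) S∈𝒮ₛ =
  ^-injectiveʳ (n<1+n 1)
    (+-cancelˡ-≡ a (2 ^ k) (2 ^ s) (trans (sym b≡a+2^k) (InLevel-length {T} {s} S∈𝒮ₛ)))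

shared-unit⇒level-≤ : ∀ {r r' k k' t} S S' → r ≤ r' →
  SegmentAtLevel r k S → SegmentAtLevel r' k' S' → UnitIn t S → UnitIn t S' → k' ≤ k
shared-unit⇒level-≤ {r} {r'} {k} {k'} {t} (a , b) (a' , b') r≤r'
  (segmentAtLevel _ b≤end _) (segmentAtLevel start'≤a' _ _) (_ , t<b) (a'≤t , _) =
  ≮⇒≥ λ k<k' → <-irrefl refl (begin-strict
    levelStart r' k'     ≤⟨ start'≤a' ⟩
    a'                   ≤⟨ a'≤t ⟩
    t                    <⟨ t<b ⟩
    b                    ≤⟨ b≤end ⟩
    levelStart r (suc k) ≤⟨ levelStart-monoʳ-≤ r k<k' ⟩
    levelStart r k'      ≤⟨ levelStart-monoˡ-≤ k' r≤r' ⟩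
    levelStart r' k'     ∎)
  where open ≤-Reasoning

lemma1 : (ℓ r r' : ℕ) → r < 2 ^ ℓ → r' < 2 ^ ℓ →
    (S S' : Segment) → S ∈ Seg ℓ r → S' ∈ Seg ℓ r' →
    (t : ℕ) → UnitIn t S → UnitIn t S' →
    r ≤ r' → (s s' : ℕ) → InLevel (2 ^ ℓ) s S → InLevel (2 ^ ℓ) s' S' →
    s' ≤ s
lemma1 ℓ r r' _ _ S S' S∈ S'∈ t unit unit' r≤r' s s' S∈𝒮ₛ S'∈𝒮ₛ'
  with formLoop-SegmentAtLevel (2 ^ ℓ) (suc ℓ) 0 r S S∈
     | formLoop-SegmentAtLevel (2 ^ ℓ) (suc ℓ) 0 r' S' S'∈
... | k , atk | k' , atk' = subst₂ _≤_
  (SegmentAtLevel∧InLevel⇒≡ (2 ^ ℓ) s' S' atk' S'∈𝒮ₛ')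
  (SegmentAtLevel∧InLevel⇒≡ (2 ^ ℓ) s S atk S∈𝒮ₛ)
  (shared-unit⇒level-≤ S S' r≤r' atk atk' unit unit')
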